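{- Let $H$ be a graph. If none of the subdivisions of $H$ is a Burling graph, then $H$ is not weakly pervasive.
   Context: A subdivision of a graph $H$ is obtained by replacing some (possibly none) of its edges by paths of length at least $1$. The class of Burling graphs is the class of all induced subgraphs of the graphs of the Burling sequence (equivalently, the class of non-oriented derived graphs); it is known that this class contains triangle-free graphs of arbitrarily large chromatic number, so it is not $\chi$-bounded. $\mathrm{Forb}^*(H)$ is the class of all graphs containing no subdivision of $H$ as an induced subgraph. A class $\mathcal C$ of graphs is $\chi$-bounded if there is a function $f$ with $\chi(G')\le f(\omega(G'))$ for every $G\in\mathcal C$ and every induced subgraph $G'$ of $G$. A graph $H$ is weakly pervasive if $\mathrm{Forb}^*(H)$ is $\chi$-bounded. -}

module Defs where

open import Data.Nat using (ℕ; zero; suc)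
open import Data.Fin using (Fin; zero; suc)
open import Data.Bool using (Bool; true; false)
open import Data.Unit using (⊤; tt)
open import Data.Empty using (⊥)
open import Data.Product using (Σ; ∃; ∃-syntax; _×_; _,_; proj₁; proj₂)
open import Data.Sum using (_⊎_; inj₁; inj₂)
open import Relation.Nullary using (¬_)
open import Relation.Binary.PropositionalEquality using (_≡_; _≢_; refl)
open import Function.Definitions using (Injective)

record FinGraph : Set₁ where
  field
    n      : ℕ
    E      : Fin n → Fin n → Set
    sym    : ∀ {u v} → E u v → E v u
    irrefl : ∀ {u} → ¬ E u u
open FinGraph public

InducedInto : (H : FinGraph) (V : Set) (R : V → V → Set) → Set
InducedInto H V R =
  Σ (Fin (n H) → V) λ f →
    Injective _≡_ _≡_ f ×
    (∀ u v → (E H u v → R (f u) (f v)) × (R (f u) (f v) → E H u v))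

_≤ᵢ_ : FinGraph → FinGraph → Set
H ≤ᵢ G = InducedInto H (Fin (n G)) (E G)

-- Subdivisions: iterated subdivision of single edges (vertex zero is the
-- new vertex, old vertex i becomes suc i).

module _ (H : FinGraph) (a b : Fin (n H)) where
  private
    SE : Fin (suc (n H)) → Fin (suc (n H)) → Set
    SE zero    zero    = ⊥
    SE zero    (suc j) = j ≡ a ⊎ j ≡ b
    SE (suc i) zero    = i ≡ a ⊎ i ≡ b
    SE (suc i) (suc j) = E H i j × ¬ ((i ≡ a × j ≡ b) ⊎ (i ≡ b × j ≡ a))

    SE-sym : ∀ {u v} → SE u v → SE v u
    SE-sym {zero}  {suc j} p = p
    SE-sym {suc i} {zero}  p = p
    SE-sym {suc i} {suc j} (e , ne) = sym H e , λ
      { (inj₁ (x , y)) → ne (inj₂ (y , x))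
      ; (inj₂ (x , y)) → ne (inj₁ (y , x)) }

    SE-irrefl : ∀ {u} → ¬ SE u u
    SE-irrefl {zero}  ()
    SE-irrefl {suc i} (e , _) = irrefl H e

  subdivideEdge : E H a b → FinGraph
  subdivideEdge _ = record { n = suc (n H) ; E = SE ; sym = SE-sym ; irrefl = SE-irrefl }

data IsSubdivision (H : FinGraph) : FinGraph → Set₁ where
  here : IsSubdivision H H
  step : ∀ {G} (a b : Fin (n H)) (e : E H a b) →
         IsSubdivision (subdivideEdge H a b e) G → IsSubdivision H G

Colorable : FinGraph → ℕ → Set
Colorable G k = Σ (Fin (n G) → Fin k) λ c → ∀ u v → E G u v → c u ≢ c v

HasClique : FinGraph → ℕ → Set
HasClique G w = Σ (Fin w → Fin (n G)) λ f →
  Injective _≡_ _≡_ f × (∀ i j → i ≢ j → E G (f i) (f j))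

IsCliqueNumber : FinGraph → ℕ → Set
IsCliqueNumber G w = HasClique G w × ¬ HasClique G (suc w)

χ-bounded : (FinGraph → Set₁) → Set₁
χ-bounded C = Σ (ℕ → ℕ) λ f → (∀ G → C G → ∀ G' → G' ≤ᵢ G →
  ∀ w → IsCliqueNumber G' w → Colorable G' (f w))

Forb* : FinGraph → FinGraph → Set₁
Forb* H G = ¬ (Σ FinGraph λ H' → IsSubdivision H H' × H' ≤ᵢ G)

WeaklyPervasive : FinGraph → Set₁
WeaklyPervasive H = χ-bounded (Forb* H)

-- The Burling sequence (G_k, S_k), k ≥ 1 (index 0 here is G_1).
-- A level consists of vertices V, an index set S for the special stable
-- sets, membership mem, and adjacency Adj.

record BLevel : Set₁ where
  field
    V   : Set
    S   : Set
    mem : S → V → Set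
    Adj : V → V → Set

-- vertices of G_{k+1}: base v = vertex v of G^0; copy s v = vertex v of G^s;
-- new s t = the vertex y_{s,t} (complete to the set T = t in G^s).
data BV (A I : Set) : Set where
  base : A → BV A I
  copy : I → A → BV A I
  new  : I → I → BV A I

module Next (L : BLevel) where
  open BLevel L

  -- (s , t , true)  is  S ∪ T ;  (s , t , false)  is  S ∪ {y_{S,T}}
  mem' : S × S × Bool → BV V S → Set
  mem' (s , t , true)  (base v)     = mem s v
  mem' (s , t , true)  (copy s' v)  = s' ≡ s × mem t v
  mem' (s , t , true)  (new _ _)    = ⊥
  mem' (s , t , false) (base v)     = mem s v
  mem' (s , t , false) (copy _ _)   = ⊥
  mem' (s , t , false) (new s' t')  = s' ≡ s × t' ≡ t

  adj' : BV V S → BV V S → Set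
  adj' (base u)    (base v)    = Adj u v
  adj' (copy s u)  (copy s' v) = s ≡ s' × Adj u v
  adj' (new s t)   (copy s' v) = s ≡ s' × mem t v
  adj' (copy s' v) (new s t)   = s ≡ s' × mem t v
  adj' _           _           = ⊥

  next : BLevel
  next = record { V = BV V S ; S = S × S × Bool ; mem = mem' ; Adj = adj' }

burlingSeq : ℕ → BLevel
burlingSeq zero    = record { V = ⊤ ; S = ⊤ ; mem = λ _ _ → ⊤ ; Adj = λ _ _ → ⊥ }
burlingSeq (suc k) = Next.next (burlingSeq k)

IsBurling : FinGraph → Set
IsBurling G = ∃[ k ] InducedInto G (BLevel.V (burlingSeq k)) (BLevel.Adj (burlingSeq k))

{-# OPTIONS --safe #-}
module Submission where

-- Every Burling graph lies in Forb*(H), because an induced subdivision of H in a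
-- Burling graph would itself be Burling.  Burling graphs are not χ-bounded: the
-- graphs of the Burling sequence are triangle-free, yet every proper colouring of
-- G_{k+1} uses k+1 distinct colours on one of its special stable sets.  For the
-- induction, colour G_{k+2}: its copy G^0 yields a special set S carrying k+1
-- colours, and the copy G^S yields T carrying k+1 colours.  Either some vertex of
-- T in G^S has a colour missing from S, and S ∪ T carries k+2 colours, or the
-- colours of T are exactly those of S; then y_{S,T}, adjacent to all of T, has a
-- new colour and S ∪ {y_{S,T}} carries k+2 colours.

open import Defs
open import Relation.Nullary using (¬_)
open import Data.Nat using (ℕ; zero; suc; _+_; _*_; _≤_; s≤s)
open import Data.Nat.Properties using (≤-refl; n≤1+n)
open import Data.Fin using (Fin; zero; suc; punchOut)
open import Data.Fin.Properties
  using (_≟_; any?; all?; ¬∀⟶∃¬; punchOut-injective; <⇒notInjective; +↔⊎; *↔×; 1↔⊤; 2↔Bool)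
open import Data.Vec.Functional using (_∷_)
open import Data.Vec.Functional.Relation.Unary.All using (All)
open import Data.Bool using (true; false)
open import Data.Unit using (tt)
open import Data.Empty using (⊥; ⊥-elim)
open import Data.Product using (Σ; ∃; ∃₂; _×_; _,_; proj₁; proj₂)
open import Data.Sum using (_⊎_; inj₁; inj₂)
open import Function using (_∘_; id)
open import Function.Bundles using (_↔_; mk↔ₛ′; Inverse; Injection)
open import Function.Definitions using (Injective)
open import Function.Properties.Inverse using (↔-trans; ↔-sym; ↔⇒↣)
open import Data.Sum.Function.Propositional using (_⊎-↔_)
open import Data.Product.Function.NonDependent.Propositional using (_×-↔_)
open import Relation.Nullary using (yes; no; ¬?; contradiction)
open import Relation.Nullary.Decidable using (decidable-stable)
open import Relation.Binary.Definitions using (Symmetric; Irreflexive)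
open import Relation.Binary.PropositionalEquality
  using (_≡_; _≢_; refl; trans; cong; subst₂) renaming (sym to ≡-sym)

injective⇒surjective : ∀ {n} {p : Fin n → Fin n} → Injective _≡_ _≡_ p →
                       ∀ i → ∃ λ j → p j ≡ i
injective⇒surjective {suc n} {p} p-injective i with any? (λ j → p j ≟ i)
... | yes hit  = hit
... | no  miss = ⊥-elim (<⇒notInjective ≤-refl punchOut∘p-injective)
  where
    i≢p : ∀ j → i ≢ p j
    i≢p j i≡pj = miss (j , ≡-sym i≡pj)

    punchOut∘p-injective : Injective _≡_ _≡_ (λ j → punchOut (i≢p j))
    punchOut∘p-injective {a} {b} = p-injective ∘ punchOut-injective (i≢p a) (i≢p b)

Fresh : ∀ {n m} → (Fin n → Fin m) → Fin m → Set
Fresh colours x = ∀ i → x ≢ colours i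

¬fresh⇒∈-image : ∀ {n m} (colours : Fin n → Fin m) x →
                   ¬ Fresh colours x → ∃ λ i → x ≡ colours i
¬fresh⇒∈-image {n} colours x not-fresh
  with i , ¬x≢ci ← ¬∀⟶∃¬ n _ (λ i → ¬? (x ≟ colours i)) not-fresh
  = i , decidable-stable (x ≟ colours i) ¬x≢ci

-- If the n colours b are all among the n colours a, they are exactly the colours
-- of a, so a colour y avoiding b also avoids a.
fresh-or-fresh : ∀ {n m} (a b : Fin n → Fin m) → Injective _≡_ _≡_ b →
                 ∀ y → Fresh b y → (∃ λ j → Fresh a (b j)) ⊎ Fresh a y
fresh-or-fresh a b b-injective y y-fresh with any? (λ j → all? (λ i → ¬? (b j ≟ a i)))
... | yes found = inj₁ found
... | no  none  = inj₂ y-fresh-for-a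
  where
    hit : ∀ j → ∃ λ i → b j ≡ a i
    hit j = ¬fresh⇒∈-image a (b j) (λ fresh → none (j , fresh))

    index : Fin _ → Fin _
    index = proj₁ ∘ hit

    index-injective : Injective _≡_ _≡_ index
    index-injective {j} {j′} eq =
      b-injective (trans (proj₂ (hit j)) (trans (cong a eq) (≡-sym (proj₂ (hit j′)))))

    y-fresh-for-a : Fresh a y
    y-fresh-for-a i y≡ai with j , index-j≡i ← injective⇒surjective index-injective i =
      y-fresh j (trans y≡ai (≡-sym (trans (proj₂ (hit j)) (cong a index-j≡i))))

All-∷ : ∀ {A : Set} {P : A → Set} {n x} {xs : Fin n → A} →
        P x → All P xs → All P (x ∷ xs)
All-∷ px pxs zero    = px
All-∷ px pxs (suc i) = pxs i

∷-colour-injective : ∀ {A : Set} {n m x} {xs : Fin n → A} (c : A → Fin m) →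
                     Injective _≡_ _≡_ (c ∘ xs) → Fresh (c ∘ xs) (c x) →
                     Injective _≡_ _≡_ (c ∘ (x ∷ xs))
∷-colour-injective c inj fresh {zero}  {zero}  eq = refl
∷-colour-injective c inj fresh {zero}  {suc j} eq = contradiction eq (fresh j)
∷-colour-injective c inj fresh {suc i} {zero}  eq = contradiction (≡-sym eq) (fresh i)
∷-colour-injective c inj fresh {suc i} {suc j} eq = cong suc (inj eq)

ProperColouring : ∀ {V : Set} → (V → V → Set) → ∀ {m} → (V → Fin m) → Set
ProperColouring R c = ∀ {u v} → R u v → c u ≢ c v

TriangleFree : ∀ {V : Set} → (V → V → Set) → Set
TriangleFree R = ∀ a b c → R a b → R b c → R a c → ⊥

module _ (L : BLevel) where
  open BLevel L

  SpecialSetsStable : Set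
  SpecialSetsStable = ∀ s {u v} → mem s u → mem s v → ¬ Adj u v

  HasSpecialVertex : Set
  HasSpecialVertex = ∃₂ λ s v → mem s v

  SpecialSetsForceColours : ℕ → Set
  SpecialSetsForceColours n = ∀ {m} (c : V → Fin m) → ProperColouring Adj c →
    ∃₂ λ s (w : Fin n → V) → All (mem s) w × Injective _≡_ _≡_ (c ∘ w)

module NextLevel (L : BLevel) where
  open BLevel L
  open Next L

  next-symmetric : Symmetric Adj → Symmetric adj'
  next-symmetric sym-Adj {base u}   {base v}    e          = sym-Adj e
  next-symmetric sym-Adj {copy _ u} {copy _ v}  (refl , e) = refl , sym-Adj e
  next-symmetric sym-Adj {new _ _}  {copy _ _}  e          = e
  next-symmetric sym-Adj {copy _ _} {new _ _}   e          = e

  next-irreflexive : Irreflexive _≡_ Adj → Irreflexive _≡_ adj'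
  next-irreflexive irr {base u}   refl e       = irr refl e
  next-irreflexive irr {copy _ u} refl (_ , e) = irr refl e

  next-stable : SpecialSetsStable L → SpecialSetsStable next
  next-stable stable (s , t , true)  {base _}   {base _}   mu       mv       e       = stable s mu mv e
  next-stable stable (s , t , true)  {copy _ _} {copy _ _} (_ , mu) (_ , mv) (_ , e) = stable t mu mv e
  next-stable stable (s , t , false) {base _}   {base _}   mu       mv       e       = stable s mu mv e
  next-stable stable (s , t , false) {base _}   {new _ _}  _        _        ()
  next-stable stable (s , t , false) {new _ _}  {new _ _}  _        _        ()

  -- A triangle through y_{S,T} would put an edge inside the stable set T.
  next-triangleFree : SpecialSetsStable L → TriangleFree Adj → TriangleFree adj'
  next-triangleFree stable tf (base _) (base _) (base _) ab bc ac = tf _ _ _ ab bc ac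
  next-triangleFree stable tf (copy _ _) (copy _ _) (copy _ _) (_ , ab) (_ , bc) (_ , ac) =
    tf _ _ _ ab bc ac
  next-triangleFree stable tf (new _ t) (copy _ _) (copy _ _) (_ , b∈t) (_ , bc) (_ , c∈t) =
    stable t b∈t c∈t bc
  next-triangleFree stable tf (copy _ _) (new _ t) (copy _ _) (_ , a∈t) (_ , c∈t) (_ , ac) =
    stable t a∈t c∈t ac
  next-triangleFree stable tf (copy _ _) (copy _ _) (new _ t) (_ , ab) (_ , b∈t) (_ , a∈t) =
    stable t a∈t b∈t ab

  next-hasSpecialVertex : HasSpecialVertex L → HasSpecialVertex next
  next-hasSpecialVertex (s , _ , _) = (s , s , false) , new s s , refl , refl

  next-hasEdge : HasSpecialVertex L → ∃₂ adj'
  next-hasEdge (s , v , v∈s) = new s s , copy s v , refl , v∈s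

  next-forcesColours : ∀ {n} → SpecialSetsForceColours L n → SpecialSetsForceColours next (suc n)
  next-forcesColours force c proper
    with s , w , w∈s , w-injective ← force (c ∘ base) proper
    with t , u , u∈t , u-injective ← force (c ∘ copy s) (λ e → proper (refl , e))
    with fresh-or-fresh (c ∘ base ∘ w) (c ∘ copy s ∘ u) u-injective (c (new s t))
                        (λ j → proper (refl , u∈t j))
  ... | inj₁ (j , fresh) =
    (s , t , true) , copy s (u j) ∷ base ∘ w ,
    All-∷ {P = mem' (s , t , true)} (refl , u∈t j) w∈s , ∷-colour-injective c w-injective fresh
  ... | inj₂ fresh =
    (s , t , false) , new s t ∷ base ∘ w ,
    All-∷ {P = mem' (s , t , false)} (refl , refl) w∈s , ∷-colour-injective c w-injective fresh

Vertex : ℕ → Set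
Vertex k = BLevel.V (burlingSeq k)

Adjacent : ∀ k → Vertex k → Vertex k → Set
Adjacent k = BLevel.Adj (burlingSeq k)

burling-symmetric : ∀ k → Symmetric (Adjacent k)
burling-symmetric zero    ()
-- The vertices are passed explicitly: Agda cannot recover them by inverting adj'.
burling-symmetric (suc k) {u} {v} =
  NextLevel.next-symmetric (burlingSeq k) (burling-symmetric k) {u} {v}

burling-irreflexive : ∀ k → Irreflexive _≡_ (Adjacent k)
burling-irreflexive zero    _ ()
burling-irreflexive (suc k) = NextLevel.next-irreflexive (burlingSeq k) (burling-irreflexive k)

burling-stable : ∀ k → SpecialSetsStable (burlingSeq k)
burling-stable zero    _ _ _ ()
burling-stable (suc k) = NextLevel.next-stable (burlingSeq k) (burling-stable k)

burling-triangleFree : ∀ k → TriangleFree (Adjacent k)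
burling-triangleFree zero    _ _ _ ()
burling-triangleFree (suc k) =
  NextLevel.next-triangleFree (burlingSeq k) (burling-stable k) (burling-triangleFree k)

burling-hasSpecialVertex : ∀ k → HasSpecialVertex (burlingSeq k)
burling-hasSpecialVertex zero    = tt , tt , tt
burling-hasSpecialVertex (suc k) =
  NextLevel.next-hasSpecialVertex (burlingSeq k) (burling-hasSpecialVertex k)

burling-hasEdge : ∀ k → ∃₂ (Adjacent (suc k))
burling-hasEdge k = NextLevel.next-hasEdge (burlingSeq k) (burling-hasSpecialVertex k)

burling-forcesColours : ∀ k → SpecialSetsForceColours (burlingSeq k) (suc k)
burling-forcesColours zero    c _ = tt , (λ _ → tt) , (λ _ → tt) , λ { {zero} {zero} _ → refl }
burling-forcesColours (suc k) =
  NextLevel.next-forcesColours (burlingSeq k) (burling-forcesColours k)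

BV↔⊎ : ∀ {A I : Set} → BV A I ↔ (A ⊎ (I × A) ⊎ (I × I))
BV↔⊎ {A} {I} = mk↔ₛ′ to from to∘from from∘to
  where
    to : BV A I → A ⊎ (I × A) ⊎ (I × I)
    to (base a)   = inj₁ a
    to (copy i a) = inj₂ (inj₁ (i , a))
    to (new i j)  = inj₂ (inj₂ (i , j))
    from : A ⊎ (I × A) ⊎ (I × I) → BV A I
    from (inj₁ a)              = base a
    from (inj₂ (inj₁ (i , a))) = copy i a
    from (inj₂ (inj₂ (i , j))) = new i j
    to∘from : ∀ x → to (from x) ≡ x
    to∘from (inj₁ a)              = refl
    to∘from (inj₂ (inj₁ (i , a))) = refl
    to∘from (inj₂ (inj₂ (i , j))) = refl
    from∘to : ∀ x → from (to x) ≡ x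
    from∘to (base a)   = refl
    from∘to (copy i a) = refl
    from∘to (new i j)  = refl

specialSetCount : ℕ → ℕ
specialSetCount zero    = 1
specialSetCount (suc k) = specialSetCount k * (specialSetCount k * 2)

vertexCount : ℕ → ℕ
vertexCount zero    = 1
vertexCount (suc k) =
  vertexCount k + (specialSetCount k * vertexCount k + specialSetCount k * specialSetCount k)

enumerateSpecialSets : ∀ k → Fin (specialSetCount k) ↔ BLevel.S (burlingSeq k)
enumerateSpecialSets zero    = 1↔⊤
enumerateSpecialSets (suc k) =
  ↔-trans *↔× (enumerateSpecialSets k ×-↔ ↔-trans *↔× (enumerateSpecialSets k ×-↔ 2↔Bool))

enumerateVertices : ∀ k → Fin (vertexCount k) ↔ Vertex k
enumerateVertices zero    = 1↔⊤
enumerateVertices (suc k) =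
  ↔-trans +↔⊎ (↔-trans (enumerateVertices k ⊎-↔ ↔-trans +↔⊎
    (↔-trans *↔× (S ×-↔ enumerateVertices k) ⊎-↔ ↔-trans *↔× (S ×-↔ S))) (↔-sym BV↔⊎))
  where
    S : Fin (specialSetCount k) ↔ BLevel.S (burlingSeq k)
    S = enumerateSpecialSets k

module FinitePresentation {N : ℕ} {V : Set} (enum : Fin N ↔ V) (R : V → V → Set)
                          (R-sym : Symmetric R) (R-irr : Irreflexive _≡_ R) where
  open Inverse enum renaming (to to vertex; from to index)

  graph : FinGraph
  graph = record
    { n = N ; E = λ i j → R (vertex i) (vertex j) ; sym = R-sym ; irrefl = R-irr refl }

  graph-inducedInto : InducedInto graph V R
  graph-inducedInto = vertex , Injection.injective (↔⇒↣ enum) , λ _ _ → id , id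

  R⇒E : ∀ {u v} → R u v → E graph (index u) (index v)
  R⇒E {u} {v} = subst₂ R (≡-sym (strictlyInverseˡ u)) (≡-sym (strictlyInverseˡ v))

  colouring⇒proper : ∀ {m} → Colorable graph m → Σ (V → Fin m) (ProperColouring R)
  colouring⇒proper (c , proper) = c ∘ index , λ e → proper _ _ (R⇒E e)

  edge⇒clique : ∀ {u v} → R u v → HasClique graph 2
  edge⇒clique {u} {v} e = pair , pair-injective , pair-adjacent
    where
      pair : Fin 2 → Fin N
      pair zero    = index u
      pair (suc _) = index v

      u≢v : index u ≢ index v
      u≢v eq = R-irr u≡v e
        where
          u≡v : u ≡ v
          u≡v = trans (≡-sym (strictlyInverseˡ u)) (trans (cong vertex eq) (strictlyInverseˡ v))

      pair-injective : Injective _≡_ _≡_ pair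
      pair-injective {zero}     {zero}     _  = refl
      pair-injective {zero}     {suc zero} eq = contradiction eq u≢v
      pair-injective {suc zero} {zero}     eq = contradiction (≡-sym eq) u≢v
      pair-injective {suc zero} {suc zero} _  = refl

      pair-adjacent : ∀ i j → i ≢ j → E graph (pair i) (pair j)
      pair-adjacent zero       zero       i≢j = contradiction refl i≢j
      pair-adjacent zero       (suc zero) _   = R⇒E e
      pair-adjacent (suc zero) zero       _   = R⇒E (R-sym e)
      pair-adjacent (suc zero) (suc zero) i≢j = contradiction refl i≢j

  triangleFree⇒¬clique₃ : TriangleFree R → ¬ HasClique graph 3
  triangleFree⇒¬clique₃ tf (_ , _ , adjacent) =
    tf _ _ _ (adjacent zero (suc zero) λ ()) (adjacent (suc zero) (suc (suc zero)) λ ())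
       (adjacent zero (suc (suc zero)) λ ())

module BurlingGraph (k : ℕ) =
  FinitePresentation (enumerateVertices k) (Adjacent k) (burling-symmetric k) (burling-irreflexive k)

burlingGraph : ℕ → FinGraph
burlingGraph = BurlingGraph.graph

burlingGraph-isBurling : ∀ k → IsBurling (burlingGraph k)
burlingGraph-isBurling k = k , BurlingGraph.graph-inducedInto k

burlingGraph-cliqueNumber : ∀ k → IsCliqueNumber (burlingGraph (suc k)) 2
burlingGraph-cliqueNumber k with u , v , u~v ← burling-hasEdge k =
  BurlingGraph.edge⇒clique (suc k) {u} {v} u~v ,
  BurlingGraph.triangleFree⇒¬clique₃ (suc k) (burling-triangleFree (suc k))

burlingGraph-uncolourable : ∀ {k m} → m ≤ k → ¬ Colorable (burlingGraph k) m
burlingGraph-uncolourable {k} m≤k colouring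
  with c , proper ← BurlingGraph.colouring⇒proper k colouring
  with _ , _ , _ , distinct ← burling-forcesColours k c proper
  = <⇒notInjective (s≤s m≤k) distinct

≤ᵢ-refl : ∀ G → G ≤ᵢ G
≤ᵢ-refl G = id , id , λ _ _ → id , id

≤ᵢ-InducedInto-trans : ∀ {H G V R} → H ≤ᵢ G → InducedInto G V R → InducedInto H V R
≤ᵢ-InducedInto-trans (f , f-inj , f-iff) (g , g-inj , g-iff) =
  g ∘ f , f-inj ∘ g-inj ,
  λ u v → proj₁ (g-iff (f u) (f v)) ∘ proj₁ (f-iff u v) ,
          proj₂ (f-iff u v) ∘ proj₂ (g-iff (f u) (f v))

≤ᵢ-preserves-isBurling : ∀ {H G} → H ≤ᵢ G → IsBurling G → IsBurling H
≤ᵢ-preserves-isBurling {H} {G} H≤G (k , G↪Bk) =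
  k , ≤ᵢ-InducedInto-trans {H} {G} {Vertex k} {Adjacent k} H≤G G↪Bk

burling⊆Forb* : ∀ {H} → (∀ H′ → IsSubdivision H H′ → ¬ IsBurling H′) →
                ∀ G → IsBurling G → Forb* H G
burling⊆Forb* no-burling G G-burling (H′ , subdivision , H′≤G) =
  no-burling H′ subdivision (≤ᵢ-preserves-isBurling {H′} {G} H′≤G G-burling)

burling⊆⇒¬χ-bounded : (C : FinGraph → Set₁) → (∀ G → IsBurling G → C G) → ¬ χ-bounded C
burling⊆⇒¬χ-bounded C burling⊆C (f , bound) =
  burlingGraph-uncolourable (n≤1+n (f 2))
    (bound G (burling⊆C G (burlingGraph-isBurling (suc (f 2)))) G (≤ᵢ-refl G) 2
           (burlingGraph-cliqueNumber (f 2)))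
  where
    G : FinGraph
    G = burlingGraph (suc (f 2))

mainTheorem19 : (H : FinGraph) →
    (∀ H' → IsSubdivision H H' → ¬ IsBurling H') →
    ¬ WeaklyPervasive H
mainTheorem19 H no-burling = burling⊆⇒¬χ-bounded (Forb* H) (burling⊆Forb* no-burling)
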